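{- Let $q$ be a prime power, $n\in\mathbb{Z}$ and $r\in\mathbb{N}_0$. Let $n=\sum_{i=0}^r a_i s_q(r,i)$ be the $S_q(r)$-adic expansion of $n$. Then there exists a $q^r$-divisible multiset of points over $\mathbb{F}_q$ of cardinality $n$ if and only if the leading coefficient $a_r$ is non-negative.
   Context: For $r\in\mathbb{N}_0$ and $i\in\{0,\dots,r\}$ let $s_q(r,i)=\sum_{j=i}^r q^j=q^i+q^{i+1}+\dots+q^r$. Every $n\in\mathbb{Z}$ has a unique representation $n=\sum_{i=0}^r a_i s_q(r,i)$ with $a_0,\dots,a_{r-1}\in\{0,1,\dots,q-1\}$ and $a_r\in\mathbb{Z}$; this is the $S_q(r)$-adic expansion of $n$, and $a_r$ is its leading coefficient. For a finite-dimensional $\mathbb{F}_q$-vector space $V$, points are $1$-dimensional subspaces and hyperplanes are subspaces of codimension $1$. A multiset of points $\mathcal{P}$ in $V$ is a function $\chi_{\mathcal{P}}$ from the points of $V$ to $\mathbb{N}_0$, with cardinality $\#\mathcal{P}=\sum_P\chi_{\mathcal{P}}(P)$, and $\#(\mathcal{P}\cap H)=\sum_{P\le H}\chi_{\mathcal{P}}(P)$. For $r\le \dim V-1$, $\mathcal{P}$ is $q^r$-divisible if $\#(\mathcal{P}\cap H)\equiv\#\mathcal{P}\pmod{q^r}$ for every hyperplane $H$ of $V$. "A $q^r$-divisible multiset of points over $\mathbb{F}_q$" means one that is $q^r$-divisible in some finite-dimensional $\mathbb{F}_q$-vector space $V$ with $\dim V>r$. -}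

module Defs where

open import Level using (Level; _⊔_) renaming (suc to lsuc)
open import Data.Nat as ℕ using (ℕ; zero; suc; _∸_; _^_)
open import Data.Fin using (Fin; toℕ; fromℕ) renaming (zero to fzero; suc to fsuc)
open import Data.Integer as ℤ using (ℤ; +_)
open import Data.Integer.Divisibility using () renaming (_∣_ to _∣ℤ_)
open import Data.List using (List; []; _∷_; length)
open import Data.Product using (Σ; ∃; _×_; _,_)
open import Relation.Nullary using (¬_; Dec; yes; no)
open import Relation.Binary using (Decidable)
open import Relation.Binary.PropositionalEquality using (_≡_)
open import Algebra.Bundles using (CommutativeRing)

-- We additionally record decidability of ≈ (automatic for finite
-- fields classically; needed to count points in hyperplanes).

record FiniteField (c ℓ : Level) (q : ℕ) : Set (lsuc (c ⊔ ℓ)) where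
  field
    cring      : CommutativeRing c ℓ
  open CommutativeRing cring public
  field
    0≉1        : ¬ (0# ≈ 1#)
    inverse    : ∀ x → ¬ (x ≈ 0#) → Σ Carrier λ y → (x * y) ≈ 1#
    _≟F_       : Decidable _≈_
    enum       : Fin q → Carrier
    enum-surj  : ∀ x → Σ (Fin q) λ i → enum i ≈ x
    enum-inj   : ∀ i j → enum i ≈ enum j → i ≡ j

sumℤ : ∀ {k} → (Fin k → ℤ) → ℤ
sumℤ {zero}  f = + 0
sumℤ {suc k} f = f fzero ℤ.+ sumℤ (λ i → f (fsuc i))

geomFrom : ℕ → ℕ → ℕ → ℕ
geomFrom q i zero    = 0
geomFrom q i (suc m) = q ^ i ℕ.+ geomFrom q (suc i) m

s : ℕ → ℕ → ℕ → ℕ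
s q r i = geomFrom q i (suc (r ∸ i))

IsSAdicExpansion : (q : ℕ) (r : ℕ) (n : ℤ) (a : Fin (suc r) → ℤ) → Set
IsSAdicExpansion q r n a =
  (∀ (i : Fin (suc r)) → toℕ i ℕ.< r → (+ 0 ℤ.≤ a i) × (a i ℤ.< + q))
  × (n ≡ sumℤ (λ i → a i ℤ.* + s q r (toℕ i)))

leading : ∀ {r} → (Fin (suc r) → ℤ) → ℤ
leading {r} a = a (fromℕ r)

-- Geometry of V = F^k (every k-dimensional F-space is isomorphic to it).

module Geometry {c ℓ q} (F : FiniteField c ℓ q) where
  open FiniteField F

  Vector : ℕ → Set c
  Vector k = Fin k → Carrier

  IsZeroVec : ∀ {k} → Vector k → Set ℓ
  IsZeroVec v = ∀ i → v i ≈ 0#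

  dot : ∀ {k} → Vector k → Vector k → Carrier
  dot {zero}  a v = 0#
  dot {suc k} a v = (a fzero * v fzero) + dot (λ i → a (fsuc i)) (λ i → v (fsuc i))

  -- A point (1-dimensional subspace) is given by a nonzero spanning
  -- vector; a multiset of points is a finite list of such vectors, the
  -- multiplicity of a point being the number of list entries spanning it.
  PointRep : ℕ → Set (c ⊔ ℓ)
  PointRep k = Σ (Vector k) λ v → ¬ IsZeroVec v

  MultisetOfPoints : ℕ → Set (c ⊔ ℓ)
  MultisetOfPoints k = List (PointRep k)

  -- A hyperplane is the kernel of a nonzero linear functional x ↦ a·x.
  HyperplaneRep : ℕ → Set (c ⊔ ℓ)
  HyperplaneRep k = Σ (Vector k) λ a → ¬ IsZeroVec a

  countIn : ∀ {k} → HyperplaneRep k → MultisetOfPoints k → ℕ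
  countIn H [] = 0
  countIn (a , a≠0) ((v , _) ∷ ps) with dot a v ≟F 0#
  ... | yes _ = suc (countIn (a , a≠0) ps)
  ... | no  _ = countIn (a , a≠0) ps

  card : ∀ {k} → MultisetOfPoints k → ℕ
  card = length

  IsDivisible : ∀ {k} → ℕ → MultisetOfPoints k → Set (c ⊔ ℓ)
  IsDivisible r P =
    ∀ (H : HyperplaneRep _) → (+ (q ^ r)) ∣ℤ ((+ countIn H P) ℤ.- (+ card P))

ExistsDivisibleMultiset : ∀ {c ℓ q} → FiniteField c ℓ q → ℕ → ℤ → Set (c ⊔ ℓ)
ExistsDivisibleMultiset F r n =
  Σ ℕ λ k → (r ℕ.< k) × Σ (MultisetOfPoints k) λ P →
    IsDivisible r P × (+ card P ≡ n)
  where open Geometry F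

open import Data.Nat.Primality using (Prime)
IsPrimePower : ℕ → Set
IsPrimePower q = Σ ℕ λ p → Σ ℕ λ m → Prime p × (1 ℕ.≤ m) × (q ≡ p ^ m)

-- Sufficiency: if a_r ≥ 0, take a_0 copies of the point set of PG(r, q) and add q copies of a
-- q^(r-1)-divisible multiset of cardinality Σ_{i ≥ 1} a_i s_q(r-1, i-1), placed inside a hyperplane.
-- Every hyperplane misses exactly q^r points of PG(r, q), and |PG(r, q)| = s_q(r, 0), so both parts
-- are q^r-divisible, and their cardinalities add up to n because q s_q(r-1, i-1) = s_q(r, i).
--
-- Necessity, by induction on r: averaging over the q^k hyperplanes not through (1, 0, …, 0) gives
-- a hyperplane H with q #(P ∩ H) ≤ #P.  The restriction P ∩ H is q^(r-1)-divisible (count the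
-- pencil of hyperplanes through H ∩ K), and #(P ∩ H) = n + u q^r has the S_q(r-1)-adic expansion
-- (a_0, …, a_(r-2), a_(r-1) + q (Σ a_i + u)), so induction gives Σ a_i + u ≥ 0.  Multiplying n by
-- q - 1 telescopes s_q(r, i) into q^(r+1) - q^i, and then q #(P ∩ H) ≤ #P forces a_r ≥ 0.

module Submission where

open import Defs
open import Level using (Level)
open import Data.Nat using (ℕ; suc)
open import Data.Fin using (Fin)
open import Data.Integer using (ℤ; +_; _≤_; ∣_∣)
open import Function.Bundles using (_⇔_; mk⇔)

open import Data.Nat as ℕ using (zero; _+_; _*_; _∸_; _^_; z≤n; s≤s)
import Data.Nat.Properties as ℕP
open import Data.Fin as Fin using (toℕ; fromℕ; inject₁) renaming (zero to fzero; suc to fsuc)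
import Data.Fin.Properties as FinP
import Data.Integer as ℤ
import Data.Integer.Properties as ℤP
import Data.Integer.Divisibility.Signed as DS
open import Data.Integer.Divisibility using () renaming (_∣_ to _∣ℤ_)
open import Data.Integer.Tactic.RingSolver using (solve-∀)
open import Data.List using (List; []; _∷_; _++_; length; concat; tabulate; map; filter)
import Data.List.Properties as ListP
open import Data.Vec.Functional as Vec using (init; last; tail; updateAt; removeAt)
open import Data.Vec.Functional.Properties using (updateAt-updates; updateAt-minimal)
open import Data.Product using (∃; Σ; _×_; _,_; proj₁; proj₂)
open import Data.Empty using (⊥-elim)
open import Function using (_∘_)
open import Relation.Nullary using (¬_; Dec; yes; no)
open import Relation.Binary.PropositionalEquality
import Relation.Binary.Reasoning.Setoid
import Algebra.Properties.Group
import Algebra.Properties.CommutativeSemigroup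
import Algebra.Properties.Semiring.Sum

private
  variable
    ℓa ℓb : Level
    A : Set ℓa
    B : Set ℓb

module Σℕ = Algebra.Properties.Semiring.Sum ℕP.+-*-semiring
module Σℤ = Algebra.Properties.Semiring.Sum ℤP.+-*-semiring
module ℤ* = Algebra.Properties.CommutativeSemigroup ℤP.*-commutativeSemigroup
open Algebra.Properties.CommutativeSemigroup ℕP.+-commutativeSemigroup using (interchange)

sumOver : (A → ℕ) → List A → ℕ
sumOver f []       = 0
sumOver f (x ∷ xs) = f x + sumOver f xs

sumOver-cong : ∀ {f g : A → ℕ} → (∀ x → f x ≡ g x) → ∀ xs → sumOver f xs ≡ sumOver g xs
sumOver-cong f≗g []       = refl
sumOver-cong f≗g (x ∷ xs) = cong₂ _+_ (f≗g x) (sumOver-cong f≗g xs)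

sumOver-++ : ∀ (f : A → ℕ) xs ys → sumOver f (xs ++ ys) ≡ sumOver f xs + sumOver f ys
sumOver-++ f []       ys = refl
sumOver-++ f (x ∷ xs) ys = trans (cong (_+_ (f x)) (sumOver-++ f xs ys)) (sym (ℕP.+-assoc (f x) _ _))

sumOver-+ : ∀ (f g : A → ℕ) xs → sumOver (λ x → f x + g x) xs ≡ sumOver f xs + sumOver g xs
sumOver-+ f g []       = refl
sumOver-+ f g (x ∷ xs) = begin
  f x + g x + sumOver (λ x → f x + g x) xs     ≡⟨ cong (_+_ (f x + g x)) (sumOver-+ f g xs) ⟩
  f x + g x + (sumOver f xs + sumOver g xs)   ≡⟨ interchange (f x) (g x) _ _ ⟩
  f x + sumOver f xs + (g x + sumOver g xs)   ∎
  where open ≡-Reasoning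

sumOver-*ˡ : ∀ k (f : A → ℕ) xs → sumOver (λ x → k * f x) xs ≡ k * sumOver f xs
sumOver-*ˡ k f []       = sym (ℕP.*-zeroʳ k)
sumOver-*ˡ k f (x ∷ xs) =
  trans (cong (_+_ (k * f x)) (sumOver-*ˡ k f xs)) (sym (ℕP.*-distribˡ-+ k (f x) _))

sumOver-const : ∀ c (xs : List A) → sumOver (λ _ → c) xs ≡ length xs * c
sumOver-const c []       = refl
sumOver-const c (x ∷ xs) = cong (_+_ c) (sumOver-const c xs)

length≡sumOver-1 : ∀ (xs : List A) → length xs ≡ sumOver (λ _ → 1) xs
length≡sumOver-1 xs = sym (trans (sumOver-const 1 xs) (ℕP.*-identityʳ (length xs)))

sumOver-mono : ∀ {f g : A → ℕ} → (∀ x → f x ℕ.≤ g x) → ∀ xs → sumOver f xs ℕ.≤ sumOver g xs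
sumOver-mono f≤g []       = z≤n
sumOver-mono f≤g (x ∷ xs) = ℕP.+-mono-≤ (f≤g x) (sumOver-mono f≤g xs)

sumOver-map : ∀ (f : A → ℕ) (g : B → A) xs → sumOver f (map g xs) ≡ sumOver (λ x → f (g x)) xs
sumOver-map f g []       = refl
sumOver-map f g (x ∷ xs) = cong (_+_ (f (g x))) (sumOver-map f g xs)

sumOver-comm : ∀ (f : A → B → ℕ) xs ys →
               sumOver (λ x → sumOver (f x) ys) xs ≡ sumOver (λ y → sumOver (λ x → f x y) xs) ys
sumOver-comm f []       ys = sym (trans (sumOver-const 0 ys) (ℕP.*-zeroʳ (length ys)))
sumOver-comm f (x ∷ xs) ys = trans (cong (_+_ (sumOver (f x) ys)) (sumOver-comm f xs ys))
                                   (sym (sumOver-+ (f x) _ ys))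

sumOver-concat-tabulate : ∀ (f : A → ℕ) {k} (g : Fin k → List A) →
                          sumOver f (concat (tabulate g)) ≡ Σℕ.sum (λ i → sumOver f (g i))
sumOver-concat-tabulate f {k = zero}  g = refl
sumOver-concat-tabulate f {k = suc k} g =
  trans (sumOver-++ f (g fzero) _) (cong (_+_ (sumOver f (g fzero))) (sumOver-concat-tabulate f (λ i → g (fsuc i))))

∑-sumOver-comm : ∀ {k} (f : Fin k → A → ℕ) xs →
                 Σℕ.sum (λ i → sumOver (f i) xs) ≡ sumOver (λ x → Σℕ.sum (λ i → f i x)) xs
∑-sumOver-comm {k = zero}  f xs = sym (trans (sumOver-const 0 xs) (ℕP.*-zeroʳ (length xs)))
∑-sumOver-comm {k = suc k} f xs = trans (cong (_+_ (sumOver (f fzero) xs)) (∑-sumOver-comm (λ i → f (fsuc i)) xs))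
                                    (sym (sumOver-+ (f fzero) _ xs))

copies : ℕ → List A → List A
copies zero    xs = []
copies (suc n) xs = xs ++ copies n xs

sumOver-copies : ∀ (f : A → ℕ) n xs → sumOver f (copies n xs) ≡ n * sumOver f xs
sumOver-copies f zero    xs = refl
sumOver-copies f (suc n) xs = trans (sumOver-++ f xs (copies n xs)) (cong (_+_ (sumOver f xs)) (sumOver-copies f n xs))

sumOver<⇒∃≤ : ∀ (f : A → ℕ) n xs → sumOver f xs ℕ.< length xs * suc n → ∃ λ x → f x ℕ.≤ n
sumOver<⇒∃≤ f n []       ()
sumOver<⇒∃≤ f n (x ∷ xs) sum< with f x ℕ.≤? n
... | yes fx≤n = x , fx≤n
... | no  fx≰n = sumOver<⇒∃≤ f n xs (ℕP.+-cancelˡ-< (suc n) _ _ (ℕP.≤-<-trans (ℕP.+-monoˡ-≤ _ (ℕP.≰⇒> fx≰n)) sum<))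

∑-const : ∀ k c → Σℕ.sum {k} (λ _ → c) ≡ k * c
∑-const zero    c = refl
∑-const (suc k) c = cong (_+_ c) (∑-const k c)

∑-indicator : ∀ {k} (f : Fin k → ℕ) i₀ → (∀ i → i ≢ i₀ → f i ≡ 0) → Σℕ.sum f ≡ f i₀
∑-indicator {suc k} f i₀ f≡0 = begin
  Σℕ.sum f
    ≡⟨ Σℕ.sum-remove {i = i₀} f ⟩
  f i₀ + Σℕ.sum (removeAt f i₀)
    ≡⟨ cong (_+_ (f i₀)) (trans (Σℕ.sum-cong-≗ (λ i → f≡0 _ (FinP.punchInᵢ≢i i₀ i))) (Σℕ.sum-replicate-zero k)) ⟩
  f i₀ + 0
    ≡⟨ ℕP.+-identityʳ (f i₀) ⟩
  f i₀                              ∎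
  where open ≡-Reasoning

sumℤ≡sum : ∀ {k} (f : Fin k → ℤ) → sumℤ f ≡ Σℤ.sum f
sumℤ≡sum {zero}  f = refl
sumℤ≡sum {suc k} f = cong (ℤ._+_ (f fzero)) (sumℤ≡sum (λ i → f (fsuc i)))

+-cancelʳ-≤ : ∀ {i j} k → i ℤ.+ k ≤ j ℤ.+ k → i ≤ j
+-cancelʳ-≤ {i} {j} k i+k≤j+k = subst₂ _≤_ (cancel i) (cancel j) (ℤP.+-monoˡ-≤ (ℤ.- k) i+k≤j+k)
  where
  cancel : ∀ x → x ℤ.+ k ℤ.- k ≡ x
  cancel x = trans (ℤP.+-assoc x k (ℤ.- k)) (trans (cong (ℤ._+_ x) (ℤP.+-inverseʳ k)) (ℤP.+-identityʳ x))

0<n+n*i⇒0≤i : ∀ n {i} → + 0 ℤ.< + n ℤ.+ + n ℤ.* i → + 0 ≤ i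
0<n+n*i⇒0≤i n {i} 0<n+n*i =
  +-cancelʳ-≤ (+ 1) (subst₂ _≤_ refl (ℤP.+-comm (+ 1) i) (ℤP.i<j⇒suc[i]≤j 0<1+i))
  where
  factor : ∀ x y → x ℤ.+ x ℤ.* y ≡ x ℤ.* (+ 1 ℤ.+ y)
  factor = solve-∀
  0<1+i : + 0 ℤ.< + 1 ℤ.+ i
  0<1+i = ℤP.*-cancelˡ-<-nonNeg (+ n) (subst₂ ℤ._<_ (sym (ℤP.*-zeroʳ (+ n))) (factor (+ n) i) 0<n+n*i)

∑-divisible : ∀ {k} d (f : Fin k → ℕ) n → (∀ i → d DS.∣ (+ f i ℤ.- + n)) →
              d DS.∣ (+ Σℕ.sum f ℤ.- + (k * n))
∑-divisible {zero}  d f n d∣ = DS.divides (+ 0) refl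
∑-divisible {suc k} d f n d∣ = subst (d DS.∣_) (sym regroup)
  (DS.∣m∣n⇒∣m+n (d∣ fzero) (∑-divisible d (λ i → f (fsuc i)) n (d∣ ∘ fsuc)))
  where
  open ≡-Reasoning
  split : ∀ x y u v → (x ℤ.+ y) ℤ.- (u ℤ.+ v) ≡ (x ℤ.- u) ℤ.+ (y ℤ.- v)
  split = solve-∀
  regroup : + Σℕ.sum f ℤ.- + (suc k * n) ≡ (+ f fzero ℤ.- + n) ℤ.+ (+ Σℕ.sum (λ i → f (fsuc i)) ℤ.- + (k * n))
  regroup = begin
    + (f fzero + Σℕ.sum (λ i → f (fsuc i))) ℤ.- + (n + k * n)
      ≡⟨ cong₂ ℤ._-_ (ℤP.pos-+ (f fzero) _) (ℤP.pos-+ n (k * n)) ⟩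
    (+ f fzero ℤ.+ + Σℕ.sum (λ i → f (fsuc i))) ℤ.- (+ n ℤ.+ + (k * n))
      ≡⟨ split (+ f fzero) (+ Σℕ.sum (λ i → f (fsuc i))) (+ n) (+ (k * n)) ⟩
    (+ f fzero ℤ.- + n) ℤ.+ (+ Σℕ.sum (λ i → f (fsuc i)) ℤ.- + (k * n))
      ∎

∑-updateAt-+ : ∀ {k} (a w : Fin k → ℤ) j X →
               Σℤ.sum (λ i → updateAt a j (ℤ._+ X) i ℤ.* w i) ≡ Σℤ.sum (λ i → a i ℤ.* w i) ℤ.+ X ℤ.* w j
∑-updateAt-+ a w fzero X = shuffle (a fzero) X (w fzero) (Σℤ.sum (λ i → a (fsuc i) ℤ.* w (fsuc i)))
  where
  shuffle : ∀ x y z s → (x ℤ.+ y) ℤ.* z ℤ.+ s ≡ x ℤ.* z ℤ.+ s ℤ.+ y ℤ.* z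
  shuffle = solve-∀
∑-updateAt-+ a w (fsuc j) X = trans (cong (ℤ._+_ (a fzero ℤ.* w fzero)) (∑-updateAt-+ (λ i → a (fsuc i)) (λ i → w (fsuc i)) j X))
                                    (sym (ℤP.+-assoc (a fzero ℤ.* w fzero) _ _))

-- S_q(r)-adic expansions

module Expansion (q : ℕ) where

  geomFrom-shift : ∀ i m → geomFrom q (suc i) m ≡ q * geomFrom q i m
  geomFrom-shift i zero    = sym (ℕP.*-zeroʳ q)
  geomFrom-shift i (suc m) = trans (cong (_+_ (q ^ suc i)) (geomFrom-shift (suc i) m))
                                   (sym (ℕP.*-distribˡ-+ q (q ^ i) _))

  geomFrom-snoc : ∀ i m → geomFrom q i (suc m) ≡ geomFrom q i m + q ^ (i + m)
  geomFrom-snoc i zero    = trans (ℕP.+-identityʳ (q ^ i)) (cong (q ^_) (sym (ℕP.+-identityʳ i)))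
  geomFrom-snoc i (suc m) = begin
    q ^ i + geomFrom q (suc i) (suc m)               ≡⟨ cong (_+_ (q ^ i)) (geomFrom-snoc (suc i) m) ⟩
    q ^ i + (geomFrom q (suc i) m + q ^ (suc i + m)) ≡⟨ ℕP.+-assoc (q ^ i) _ _ ⟨
    q ^ i + geomFrom q (suc i) m + q ^ (suc i + m)   ≡⟨ cong (λ e → q ^ i + geomFrom q (suc i) m + q ^ e) (ℕP.+-suc i m) ⟨
    q ^ i + geomFrom q (suc i) m + q ^ (i + suc m)   ∎
    where open ≡-Reasoning

  geomFrom-telescope : ∀ i m → q * geomFrom q i m + q ^ i ≡ geomFrom q i m + q ^ (i + m)
  geomFrom-telescope i m = begin
    q * geomFrom q i m + q ^ i     ≡⟨ cong (_+ q ^ i) (geomFrom-shift i m) ⟨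
    geomFrom q (suc i) m + q ^ i   ≡⟨ ℕP.+-comm (geomFrom q (suc i) m) (q ^ i) ⟩
    geomFrom q i (suc m)           ≡⟨ geomFrom-snoc i m ⟩
    geomFrom q i m + q ^ (i + m)   ∎
    where open ≡-Reasoning

  private
    +-suc-∸ : ∀ {i r} → i ℕ.≤ r → i + suc (r ∸ i) ≡ suc r
    +-suc-∸ {i} {r} i≤r = trans (ℕP.+-suc i (r ∸ i)) (cong suc (ℕP.m+[n∸m]≡n i≤r))

  s-diag : ∀ r → s q r r ≡ q ^ r
  s-diag r = trans (cong (λ m → geomFrom q r (suc m)) (ℕP.n∸n≡0 r)) (ℕP.+-identityʳ (q ^ r))

  s-shift : ∀ r i → s q (suc r) (suc i) ≡ q * s q r i
  s-shift r i = geomFrom-shift i (suc (r ∸ i))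

  s-suc : ∀ {r i} → i ℕ.≤ r → s q (suc r) i ≡ s q r i + q ^ suc r
  s-suc {r} {i} i≤r = begin
    geomFrom q i (suc (suc r ∸ i))       ≡⟨ cong (geomFrom q i ∘ suc) (ℕP.+-∸-assoc 1 i≤r) ⟩
    geomFrom q i (suc (suc (r ∸ i)))     ≡⟨ geomFrom-snoc i (suc (r ∸ i)) ⟩
    s q r i + q ^ (i + suc (r ∸ i))      ≡⟨ cong (λ e → s q r i + q ^ e) (+-suc-∸ i≤r) ⟩
    s q r i + q ^ suc r                  ∎
    where open ≡-Reasoning

  s-telescope : ∀ {r i} → i ℕ.≤ r → q * s q r i + q ^ i ≡ s q r i + q ^ suc r
  s-telescope {r} {i} i≤r =
    trans (geomFrom-telescope i (suc (r ∸ i))) (cong (λ e → s q r i + q ^ e) (+-suc-∸ i≤r))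

  value : ∀ r → (Fin (suc r) → ℤ) → ℤ
  value r a = Σℤ.sum (λ i → a i ℤ.* + s q r (toℕ i))

  positional : ∀ {k} → (Fin k → ℤ) → ℤ
  positional a = Σℤ.sum (λ i → a i ℤ.* + (q ^ toℕ i))

  value-zero : ∀ (a : Fin 1 → ℤ) → value 0 a ≡ a fzero
  value-zero a = trans (ℤP.+-identityʳ _) (ℤP.*-identityʳ (a fzero))

  value-tail : ∀ r (a : Fin (suc (suc r)) → ℤ) →
               value (suc r) a ≡ a fzero ℤ.* + s q (suc r) 0 ℤ.+ + q ℤ.* value r (tail a)
  value-tail r a = cong (ℤ._+_ (a fzero ℤ.* + s q (suc r) 0)) (begin
    Σℤ.sum (λ i → a (fsuc i) ℤ.* + s q (suc r) (suc (toℕ i)))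
      ≡⟨ Σℤ.sum-cong-≗ shift ⟩
    Σℤ.sum (λ i → + q ℤ.* (a (fsuc i) ℤ.* + s q r (toℕ i)))
      ≡⟨ Σℤ.*-distribˡ-sum (+ q) (λ i → a (fsuc i) ℤ.* + s q r (toℕ i)) ⟨
    + q ℤ.* value r (tail a)                                    ∎)
    where
    open ≡-Reasoning
    shift : ∀ i → a (fsuc i) ℤ.* + s q (suc r) (suc (toℕ i)) ≡ + q ℤ.* (a (fsuc i) ℤ.* + s q r (toℕ i))
    shift i = begin
      a (fsuc i) ℤ.* + s q (suc r) (suc (toℕ i))    ≡⟨ cong (λ e → a (fsuc i) ℤ.* + e) (s-shift r (toℕ i)) ⟩
      a (fsuc i) ℤ.* + (q * s q r (toℕ i))          ≡⟨ cong (ℤ._*_ (a (fsuc i))) (ℤP.pos-* q _) ⟩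
      a (fsuc i) ℤ.* (+ q ℤ.* + s q r (toℕ i))      ≡⟨ ℤ*.x∙yz≈y∙xz (a (fsuc i)) (+ q) _ ⟩
      + q ℤ.* (a (fsuc i) ℤ.* + s q r (toℕ i))      ∎

  value-suc : ∀ r (a : Fin (suc (suc r)) → ℤ) →
              value (suc r) a ≡ value r (init a) ℤ.+ Σℤ.sum a ℤ.* + (q ^ suc r)
  value-suc r a = begin
    value (suc r) a
      ≡⟨ Σℤ.sum-init-last (λ i → a i ℤ.* + s q (suc r) (toℕ i)) ⟩
    Σℤ.sum (λ i → a (inject₁ i) ℤ.* + s q (suc r) (toℕ (inject₁ i))) ℤ.+ last a ℤ.* + s q (suc r) (toℕ (fromℕ (suc r)))
      ≡⟨ cong₂ ℤ._+_ (Σℤ.sum-cong-≗ split) (cong (λ e → last a ℤ.* + e) (trans (cong (s q (suc r)) (FinP.toℕ-fromℕ (suc r))) (s-diag (suc r)))) ⟩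
    Σℤ.sum (λ i → init a i ℤ.* + s q r (toℕ i) ℤ.+ init a i ℤ.* Q) ℤ.+ last a ℤ.* Q
      ≡⟨ cong (ℤ._+ last a ℤ.* Q) (Σℤ.∑-distrib-+ (λ i → init a i ℤ.* + s q r (toℕ i)) (λ i → init a i ℤ.* Q)) ⟩
    value r (init a) ℤ.+ Σℤ.sum (λ i → init a i ℤ.* Q) ℤ.+ last a ℤ.* Q
      ≡⟨ cong (λ e → value r (init a) ℤ.+ e ℤ.+ last a ℤ.* Q) (Σℤ.*-distribʳ-sum Q (init a)) ⟨
    value r (init a) ℤ.+ Σℤ.sum (init a) ℤ.* Q ℤ.+ last a ℤ.* Q
      ≡⟨ ℤP.+-assoc (value r (init a)) _ _ ⟩
    value r (init a) ℤ.+ (Σℤ.sum (init a) ℤ.* Q ℤ.+ last a ℤ.* Q)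
      ≡⟨ cong (ℤ._+_ (value r (init a))) (trans (cong (ℤ._* Q) (Σℤ.sum-init-last a)) (ℤP.*-distribʳ-+ Q (Σℤ.sum (init a)) (last a))) ⟨
    value r (init a) ℤ.+ Σℤ.sum a ℤ.* Q
      ∎
    where
    open ≡-Reasoning
    Q = + (q ^ suc r)
    split : ∀ i → a (inject₁ i) ℤ.* + s q (suc r) (toℕ (inject₁ i)) ≡ init a i ℤ.* + s q r (toℕ i) ℤ.+ init a i ℤ.* Q
    split i = begin
      a (inject₁ i) ℤ.* + s q (suc r) (toℕ (inject₁ i))
        ≡⟨ cong (λ e → a (inject₁ i) ℤ.* + s q (suc r) e) (FinP.toℕ-inject₁ i) ⟩
      a (inject₁ i) ℤ.* + s q (suc r) (toℕ i)
        ≡⟨ cong (λ e → a (inject₁ i) ℤ.* + e) (s-suc (FinP.toℕ≤pred[n] i)) ⟩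
      a (inject₁ i) ℤ.* + (s q r (toℕ i) + q ^ suc r)
        ≡⟨ cong (ℤ._*_ (a (inject₁ i))) (ℤP.pos-+ (s q r (toℕ i)) _) ⟩
      a (inject₁ i) ℤ.* (+ s q r (toℕ i) ℤ.+ Q)
        ≡⟨ ℤP.*-distribˡ-+ (a (inject₁ i)) _ Q ⟩
      init a i ℤ.* + s q r (toℕ i) ℤ.+ init a i ℤ.* Q     ∎

  value-updateLast : ∀ r (a : Fin (suc r) → ℤ) X →
                     value r (updateAt a (fromℕ r) (ℤ._+ X)) ≡ value r a ℤ.+ X ℤ.* + (q ^ r)
  value-updateLast r a X = trans (∑-updateAt-+ a (λ i → + s q r (toℕ i)) (fromℕ r) X)
    (cong (λ e → value r a ℤ.+ X ℤ.* + e) (trans (cong (s q r) (FinP.toℕ-fromℕ r)) (s-diag r)))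

  value-carry : ∀ r (a : Fin (suc (suc r)) → ℤ) u →
                value (suc r) a ℤ.+ u ℤ.* + (q ^ suc r)
                ≡ value r (updateAt (init a) (fromℕ r) (ℤ._+ + q ℤ.* (Σℤ.sum a ℤ.+ u)))
  value-carry r a u = begin
    value (suc r) a ℤ.+ u ℤ.* + (q ^ suc r)
      ≡⟨ cong (ℤ._+ u ℤ.* + (q ^ suc r)) (value-suc r a) ⟩
    value r (init a) ℤ.+ S ℤ.* + (q ^ suc r) ℤ.+ u ℤ.* + (q ^ suc r)
      ≡⟨ cong (λ e → value r (init a) ℤ.+ S ℤ.* e ℤ.+ u ℤ.* e) (ℤP.pos-* q (q ^ r)) ⟩
    value r (init a) ℤ.+ S ℤ.* (+ q ℤ.* + (q ^ r)) ℤ.+ u ℤ.* (+ q ℤ.* + (q ^ r))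
      ≡⟨ regroup (value r (init a)) S u (+ q) (+ (q ^ r)) ⟩
    value r (init a) ℤ.+ + q ℤ.* (S ℤ.+ u) ℤ.* + (q ^ r)
      ≡⟨ value-updateLast r (init a) (+ q ℤ.* (S ℤ.+ u)) ⟨
    value r (updateAt (init a) (fromℕ r) (ℤ._+ + q ℤ.* (S ℤ.+ u)))
      ∎
    where
    open ≡-Reasoning
    S = Σℤ.sum a
    regroup : ∀ v s u q Q → v ℤ.+ s ℤ.* (q ℤ.* Q) ℤ.+ u ℤ.* (q ℤ.* Q) ≡ v ℤ.+ q ℤ.* (s ℤ.+ u) ℤ.* Q
    regroup = solve-∀

  positional-suc : ∀ {k} (a : Fin (suc k) → ℤ) → positional a ≡ a fzero ℤ.+ + q ℤ.* positional (tail a)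
  positional-suc a = cong₂ ℤ._+_ (ℤP.*-identityʳ (a fzero))
    (trans (Σℤ.sum-cong-≗ shift) (sym (Σℤ.*-distribˡ-sum (+ q) (λ i → a (fsuc i) ℤ.* + (q ^ toℕ i)))))
    where
    shift : ∀ i → a (fsuc i) ℤ.* + (q * q ^ toℕ i) ≡ + q ℤ.* (a (fsuc i) ℤ.* + (q ^ toℕ i))
    shift i = trans (cong (ℤ._*_ (a (fsuc i))) (ℤP.pos-* q _)) (ℤ*.x∙yz≈y∙xz (a (fsuc i)) (+ q) _)

  positional-init-last : ∀ {k} (a : Fin (suc k) → ℤ) →
                         positional a ≡ positional (init a) ℤ.+ last a ℤ.* + (q ^ k)
  positional-init-last {k} a = trans (Σℤ.sum-init-last (λ i → a i ℤ.* + (q ^ toℕ i)))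
    (cong₂ ℤ._+_ (Σℤ.sum-cong-≗ (λ i → cong (λ e → a (inject₁ i) ℤ.* + (q ^ e)) (FinP.toℕ-inject₁ i)))
                 (cong (λ e → last a ℤ.* + (q ^ e)) (FinP.toℕ-fromℕ k)))

  positional< : ∀ {k} (a : Fin k → ℤ) → (∀ i → a i ℤ.< + q) → positional a ℤ.< + (q ^ k)
  positional< {zero}  a a<q = ℤ.+<+ (s≤s z≤n)
  positional< {suc k} a a<q = begin-strict
    positional a
      ≡⟨ positional-suc a ⟩
    a fzero ℤ.+ + q ℤ.* positional (tail a)
      <⟨ ℤP.+-monoˡ-< _ (a<q fzero) ⟩
    + q ℤ.+ + q ℤ.* positional (tail a)
      ≡⟨ trans (ℤP.*-distribˡ-+ (+ q) (+ 1) (positional (tail a))) (cong (ℤ._+ + q ℤ.* positional (tail a)) (ℤP.*-identityʳ (+ q))) ⟨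
    + q ℤ.* (+ 1 ℤ.+ positional (tail a))
      ≤⟨ ℤP.*-monoˡ-≤-nonNeg (+ q) (ℤP.i<j⇒suc[i]≤j (positional< (tail a) (a<q ∘ fsuc))) ⟩
    + q ℤ.* + (q ^ k)
      ≡⟨ ℤP.pos-* q (q ^ k) ⟨
    + (q ^ suc k)
      ∎
    where open ℤP.≤-Reasoning

  value-telescope : ∀ r (a : Fin (suc r) → ℤ) →
                    + q ℤ.* value r a ℤ.+ positional a ≡ value r a ℤ.+ Σℤ.sum a ℤ.* + (q ^ suc r)
  value-telescope r a = begin
    + q ℤ.* value r a ℤ.+ positional a
      ≡⟨ cong (ℤ._+ positional a) (Σℤ.*-distribˡ-sum (+ q) (λ i → a i ℤ.* + s q r (toℕ i))) ⟩
    Σℤ.sum (λ i → + q ℤ.* (a i ℤ.* + s q r (toℕ i))) ℤ.+ positional a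
      ≡⟨ Σℤ.∑-distrib-+ (λ i → + q ℤ.* (a i ℤ.* + s q r (toℕ i))) (λ i → a i ℤ.* + (q ^ toℕ i)) ⟨
    Σℤ.sum (λ i → + q ℤ.* (a i ℤ.* + s q r (toℕ i)) ℤ.+ a i ℤ.* + (q ^ toℕ i))
      ≡⟨ Σℤ.sum-cong-≗ term ⟩
    Σℤ.sum (λ i → a i ℤ.* + s q r (toℕ i) ℤ.+ a i ℤ.* Q)
      ≡⟨ Σℤ.∑-distrib-+ (λ i → a i ℤ.* + s q r (toℕ i)) (λ i → a i ℤ.* Q) ⟩
    value r a ℤ.+ Σℤ.sum (λ i → a i ℤ.* Q)
      ≡⟨ cong (ℤ._+_ (value r a)) (Σℤ.*-distribʳ-sum Q a) ⟨
    value r a ℤ.+ Σℤ.sum a ℤ.* Q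
      ∎
    where
    open ≡-Reasoning
    Q = + (q ^ suc r)
    collect : ∀ x y z w → x ℤ.* (y ℤ.* z) ℤ.+ y ℤ.* w ≡ y ℤ.* (x ℤ.* z ℤ.+ w)
    collect = solve-∀
    term : ∀ i → + q ℤ.* (a i ℤ.* + s q r (toℕ i)) ℤ.+ a i ℤ.* + (q ^ toℕ i) ≡ a i ℤ.* + s q r (toℕ i) ℤ.+ a i ℤ.* Q
    term i = begin
      + q ℤ.* (a i ℤ.* + s q r (toℕ i)) ℤ.+ a i ℤ.* + (q ^ toℕ i)
        ≡⟨ collect (+ q) (a i) _ _ ⟩
      a i ℤ.* (+ q ℤ.* + s q r (toℕ i) ℤ.+ + (q ^ toℕ i))
        ≡⟨ cong (λ e → a i ℤ.* (e ℤ.+ + (q ^ toℕ i))) (ℤP.pos-* q _) ⟨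
      a i ℤ.* (+ (q * s q r (toℕ i)) ℤ.+ + (q ^ toℕ i))
        ≡⟨ cong (ℤ._*_ (a i)) (ℤP.pos-+ (q * s q r (toℕ i)) _) ⟨
      a i ℤ.* + (q * s q r (toℕ i) + q ^ toℕ i)
        ≡⟨ cong (λ e → a i ℤ.* + e) (s-telescope (FinP.toℕ≤pred[n] i)) ⟩
      a i ℤ.* + (s q r (toℕ i) + q ^ suc r)
        ≡⟨ cong (ℤ._*_ (a i)) (ℤP.pos-+ (s q r (toℕ i)) _) ⟩
      a i ℤ.* (+ s q r (toℕ i) ℤ.+ Q)
        ≡⟨ ℤP.*-distribˡ-+ (a i) _ Q ⟩
      a i ℤ.* + s q r (toℕ i) ℤ.+ a i ℤ.* Q                        ∎

  last-nonneg : ∀ r (a : Fin (suc (suc r)) → ℤ) u → (∀ i → init a i ℤ.< + q) →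
                + q ℤ.* (value (suc r) a ℤ.+ u ℤ.* + (q ^ suc r)) ≤ value (suc r) a →
                + 0 ≤ Σℤ.sum a ℤ.+ u → + 0 ≤ last a
  last-nonneg r a u digits<q q[n+uQ]≤n 0≤S+u = 0<n+n*i⇒0≤i Q (begin-strict
    + 0                                       ≤⟨ ℤP.*-monoʳ-≤-nonNeg (+ (q * Q)) 0≤S+u ⟩
    (S ℤ.+ u) ℤ.* + (q * Q)                   ≤⟨ +-cancelʳ-≤ n [S+u]qQ+n≤P+n ⟩
    positional a                              ≡⟨ positional-init-last a ⟩
    positional (init a) ℤ.+ last a ℤ.* + Q    <⟨ ℤP.+-monoˡ-< _ (positional< (init a) digits<q) ⟩
    + Q ℤ.+ last a ℤ.* + Q                    ≡⟨ cong (ℤ._+_ (+ Q)) (ℤP.*-comm (last a) (+ Q)) ⟩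
    + Q ℤ.+ + Q ℤ.* last a                    ∎)
    where
    open ℤP.≤-Reasoning
    n = value (suc r) a
    S = Σℤ.sum a
    Q = q ^ suc r
    expand : ∀ s u n qQ → (s ℤ.+ u) ℤ.* qQ ℤ.+ n ≡ n ℤ.+ s ℤ.* qQ ℤ.+ u ℤ.* qQ
    expand = solve-∀
    collect : ∀ q n p u Q → q ℤ.* n ℤ.+ p ℤ.+ u ℤ.* (q ℤ.* Q) ≡ q ℤ.* (n ℤ.+ u ℤ.* Q) ℤ.+ p
    collect = solve-∀
    [S+u]qQ+n≤P+n : (S ℤ.+ u) ℤ.* + (q * Q) ℤ.+ n ≤ positional a ℤ.+ n
    [S+u]qQ+n≤P+n = begin
      (S ℤ.+ u) ℤ.* + (q * Q) ℤ.+ n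
        ≡⟨ expand S u n (+ (q * Q)) ⟩
      n ℤ.+ S ℤ.* + (q * Q) ℤ.+ u ℤ.* + (q * Q)
        ≡⟨ cong (ℤ._+ u ℤ.* + (q * Q)) (value-telescope (suc r) a) ⟨
      + q ℤ.* n ℤ.+ positional a ℤ.+ u ℤ.* + (q * Q)
        ≡⟨ cong (λ e → + q ℤ.* n ℤ.+ positional a ℤ.+ u ℤ.* e) (ℤP.pos-* q Q) ⟩
      + q ℤ.* n ℤ.+ positional a ℤ.+ u ℤ.* (+ q ℤ.* + Q)
        ≡⟨ collect (+ q) n (positional a) u (+ Q) ⟩
      + q ℤ.* (n ℤ.+ u ℤ.* + Q) ℤ.+ positional a
        ≤⟨ ℤP.+-monoˡ-≤ (positional a) q[n+uQ]≤n ⟩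
      n ℤ.+ positional a
        ≡⟨ ℤP.+-comm n (positional a) ⟩
      positional a ℤ.+ n                               ∎

  quotient-nonneg : ∀ {x t} → + 0 ≤ x ℤ.+ + q ℤ.* t → x ℤ.< + q → + 0 ≤ t
  quotient-nonneg {x} {t} 0≤x+qt x<q = 0<n+n*i⇒0≤i q (ℤP.≤-<-trans 0≤x+qt (ℤP.+-monoˡ-< (+ q ℤ.* t) x<q))

-- Counting points over F

module PointCounting {c ℓ q} (F : FiniteField c ℓ q) where
  open Geometry F
  module F = FiniteField F
  open F using (Carrier; _≈_; 0#; 1#; -_; _≟F_; enum)
    renaming (_+_ to _⊕_; _*_ to _⊛_)
  open Algebra.Properties.Group F.+-group using (inverseʳ-unique)
  module F+ = Algebra.Properties.CommutativeSemigroup F.+-commutativeSemigroup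
  module ≈-Reasoning = Relation.Binary.Reasoning.Setoid F.setoid

  instance
    q≢0 : ℕ.NonZero q
    q≢0 = FinP.nonZeroIndex (proj₁ (F.enum-surj 0#))

  linear-root : ∀ c {w} → ¬ w ≈ 0# →
                ∃ λ i₀ → (c ⊕ w ⊛ enum i₀ ≈ 0#) × (∀ i → c ⊕ w ⊛ enum i ≈ 0# → i ≡ i₀)
  linear-root c {w} w≉0 = i₀ , is-root , unique
    where
    open ≈-Reasoning
    w⁻¹ = proj₁ (F.inverse w w≉0)
    ww⁻¹≈1 : w ⊛ w⁻¹ ≈ 1#
    ww⁻¹≈1 = proj₂ (F.inverse w w≉0)
    i₀ = proj₁ (F.enum-surj (w⁻¹ ⊛ - c))
    i₀≈root : enum i₀ ≈ w⁻¹ ⊛ - c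
    i₀≈root = proj₂ (F.enum-surj (w⁻¹ ⊛ - c))
    is-root : c ⊕ w ⊛ enum i₀ ≈ 0#
    is-root = begin
      c ⊕ w ⊛ enum i₀          ≈⟨ F.+-congˡ (F.*-congˡ i₀≈root) ⟩
      c ⊕ w ⊛ (w⁻¹ ⊛ - c)      ≈⟨ F.+-congˡ (F.*-assoc w w⁻¹ (- c)) ⟨
      c ⊕ (w ⊛ w⁻¹) ⊛ - c      ≈⟨ F.+-congˡ (F.trans (F.*-congʳ ww⁻¹≈1) (F.*-identityˡ (- c))) ⟩
      c ⊕ - c                  ≈⟨ F.-‿inverseʳ c ⟩
      0#                       ∎
    solve : ∀ x → c ⊕ w ⊛ x ≈ 0# → x ≈ w⁻¹ ⊛ - c
    solve x c+wx≈0 = begin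
      x                  ≈⟨ F.*-identityˡ x ⟨
      1# ⊛ x             ≈⟨ F.*-congʳ (F.trans (F.*-comm w⁻¹ w) ww⁻¹≈1) ⟨
      (w⁻¹ ⊛ w) ⊛ x      ≈⟨ F.*-assoc w⁻¹ w x ⟩
      w⁻¹ ⊛ (w ⊛ x)      ≈⟨ F.*-congˡ (inverseʳ-unique c (w ⊛ x) c+wx≈0) ⟩
      w⁻¹ ⊛ - c          ∎
    unique : ∀ i → c ⊕ w ⊛ enum i ≈ 0# → i ≡ i₀
    unique i c+wi≈0 = F.enum-inj i i₀ (F.trans (solve (enum i) c+wi≈0) (F.sym i₀≈root))

  dot-zeroˡ : ∀ {k} (w v : Vector k) → IsZeroVec w → dot w v ≈ 0#
  dot-zeroˡ {zero}  w v w≈0 = F.refl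
  dot-zeroˡ {suc k} w v w≈0 = F.trans (F.+-cong (F.trans (F.*-congʳ (w≈0 fzero)) (F.zeroˡ _))
                                                 (dot-zeroˡ (tail w) (tail v) (w≈0 ∘ fsuc)))
                                       (F.+-identityʳ 0#)

  dot-comm : ∀ {k} (w v : Vector k) → dot w v ≈ dot v w
  dot-comm {zero}  w v = F.refl
  dot-comm {suc k} w v = F.+-cong (F.*-comm (w fzero) (v fzero)) (dot-comm (tail w) (tail v))

  dot-linearˡ : ∀ {k} (w a v : Vector k) μ → dot (λ j → w j ⊕ μ ⊛ a j) v ≈ dot w v ⊕ μ ⊛ dot a v
  dot-linearˡ {zero}  w a v μ = F.sym (F.trans (F.+-congˡ (F.zeroʳ μ)) (F.+-identityʳ 0#))
  dot-linearˡ {suc k} w a v μ = begin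
    (w fzero ⊕ μ ⊛ a fzero) ⊛ v fzero ⊕ dot (λ j → w (fsuc j) ⊕ μ ⊛ a (fsuc j)) (tail v)
      ≈⟨ F.+-cong (F.trans (F.distribʳ (v fzero) (w fzero) (μ ⊛ a fzero)) (F.+-congˡ (F.*-assoc μ (a fzero) (v fzero))))
                  (dot-linearˡ (tail w) (tail a) (tail v) μ) ⟩
    (w fzero ⊛ v fzero ⊕ μ ⊛ (a fzero ⊛ v fzero)) ⊕ (dot (tail w) (tail v) ⊕ μ ⊛ dot (tail a) (tail v))
      ≈⟨ F+.interchange _ _ _ _ ⟩
    dot w v ⊕ (μ ⊛ (a fzero ⊛ v fzero) ⊕ μ ⊛ dot (tail a) (tail v))
      ≈⟨ F.+-congˡ (F.distribˡ μ _ _) ⟨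
    dot w v ⊕ μ ⊛ dot a v
      ∎
    where open ≈-Reasoning

  isZeroVec? : ∀ {k} (v : Vector k) → Dec (IsZeroVec v)
  isZeroVec? v = FinP.all? (λ i → v i ≟F 0#)

  χ₀ : Carrier → ℕ
  χ₀ x with x ≟F 0#
  ... | yes _ = 1
  ... | no  _ = 0

  χ₀-zero : ∀ {x} → x ≈ 0# → χ₀ x ≡ 1
  χ₀-zero {x} x≈0 with x ≟F 0#
  ... | yes _   = refl
  ... | no x≉0 = ⊥-elim (x≉0 x≈0)

  χ₀-nonzero : ∀ {x} → ¬ x ≈ 0# → χ₀ x ≡ 0
  χ₀-nonzero {x} x≉0 with x ≟F 0#
  ... | yes x≈0 = ⊥-elim (x≉0 x≈0)
  ... | no _    = refl

  χ₀-cong : ∀ {x y} → x ≈ y → χ₀ x ≡ χ₀ y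
  χ₀-cong {x} {y} x≈y with y ≟F 0#
  ... | yes y≈0 = χ₀-zero (F.trans x≈y y≈0)
  ... | no y≉0  = χ₀-nonzero (λ x≈0 → y≉0 (F.trans (F.sym x≈y) x≈0))

  ∑-χ₀-linear : ∀ c {w} → ¬ w ≈ 0# → Σℕ.sum (λ i → χ₀ (c ⊕ w ⊛ enum i)) ≡ 1
  ∑-χ₀-linear c w≉0 with linear-root c w≉0
  ... | i₀ , root , unique =
    trans (∑-indicator _ i₀ (λ i i≢i₀ → χ₀-nonzero (λ isRoot → i≢i₀ (unique i isRoot)))) (χ₀-zero root)

  vectors : ∀ m → List (Vector m)
  vectors zero    = Vec.[] ∷ []
  vectors (suc m) = concat (tabulate (λ i → map (enum i Vec.∷_) (vectors m)))

  sumOver-vectors : ∀ m (h : Vector (suc m) → ℕ) →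
                    sumOver h (vectors (suc m)) ≡ Σℕ.sum (λ i → sumOver (λ x → h (enum i Vec.∷ x)) (vectors m))
  sumOver-vectors m h = trans (sumOver-concat-tabulate h (λ i → map (enum i Vec.∷_) (vectors m)))
                              (Σℕ.sum-cong-≗ (λ i → sumOver-map h (enum i Vec.∷_) (vectors m)))

  length-vectors : ∀ m → length (vectors m) ≡ q ^ m
  length-vectors zero    = refl
  length-vectors (suc m) = begin
    length (vectors (suc m))
      ≡⟨ length≡sumOver-1 (vectors (suc m)) ⟩
    sumOver (λ _ → 1) (vectors (suc m))
      ≡⟨ sumOver-vectors m (λ _ → 1) ⟩
    Σℕ.sum (λ (_ : Fin q) → sumOver (λ _ → 1) (vectors m))
      ≡⟨ Σℕ.sum-cong-≗ {q} (λ _ → trans (sym (length≡sumOver-1 (vectors m))) (length-vectors m)) ⟩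
    Σℕ.sum (λ (_ : Fin q) → q ^ m)
      ≡⟨ ∑-const q (q ^ m) ⟩
    q ^ suc m                                      ∎
    where open ≡-Reasoning

  solutions : ∀ {m} → Carrier → Vector m → ℕ
  solutions {m} c w = sumOver (λ x → χ₀ (c ⊕ dot w x)) (vectors m)

  solutions-suc : ∀ {m} c (w : Vector (suc m)) →
                  solutions c w ≡ Σℕ.sum (λ i → solutions (c ⊕ w fzero ⊛ enum i) (tail w))
  solutions-suc {m} c w = trans (sumOver-vectors m (λ x → χ₀ (c ⊕ dot w x)))
    (Σℕ.sum-cong-≗ (λ i → sumOver-cong (λ x → χ₀-cong (F.sym (F.+-assoc c (w fzero ⊛ enum i) (dot (tail w) x)))) (vectors m)))

  solutions-zero : ∀ {m} c (w : Vector m) → IsZeroVec w → solutions c w ≡ q ^ m * χ₀ c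
  solutions-zero {m} c w w≈0 = begin
    solutions c w
      ≡⟨ sumOver-cong (λ x → χ₀-cong (F.trans (F.+-congˡ (dot-zeroˡ w x w≈0)) (F.+-identityʳ c))) (vectors m) ⟩
    sumOver (λ _ → χ₀ c) (vectors m)
      ≡⟨ sumOver-const (χ₀ c) (vectors m) ⟩
    length (vectors m) * χ₀ c
      ≡⟨ cong (_* χ₀ c) (length-vectors m) ⟩
    q ^ m * χ₀ c                     ∎
    where open ≡-Reasoning

  solutions-tail-zero : ∀ {m} c (w : Vector (suc m)) → ¬ IsZeroVec w → IsZeroVec (tail w) → solutions c w ≡ q ^ m
  solutions-tail-zero {m} c w w≠0 tail≈0 = begin
    solutions c w
      ≡⟨ solutions-suc c w ⟩
    Σℕ.sum (λ i → solutions (c ⊕ w fzero ⊛ enum i) (tail w))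
      ≡⟨ Σℕ.sum-cong-≗ (λ i → solutions-zero (c ⊕ w fzero ⊛ enum i) (tail w) tail≈0) ⟩
    Σℕ.sum (λ i → q ^ m * χ₀ (c ⊕ w fzero ⊛ enum i))
      ≡⟨ Σℕ.*-distribˡ-sum (q ^ m) (λ i → χ₀ (c ⊕ w fzero ⊛ enum i)) ⟨
    q ^ m * Σℕ.sum (λ i → χ₀ (c ⊕ w fzero ⊛ enum i))
      ≡⟨ cong (q ^ m *_) (∑-χ₀-linear c head≉0) ⟩
    q ^ m * 1
      ≡⟨ ℕP.*-identityʳ (q ^ m) ⟩
    q ^ m                                                       ∎
    where
    open ≡-Reasoning
    head≉0 : ¬ w fzero ≈ 0#
    head≉0 head≈0 = w≠0 λ { fzero → head≈0 ; (fsuc j) → tail≈0 j }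

  solutions-nonzero : ∀ {m} c (w : Vector (suc m)) → ¬ IsZeroVec w → solutions c w ≡ q ^ m
  solutions-nonzero {zero}  c w w≠0 = solutions-tail-zero c w w≠0 (λ ())
  solutions-nonzero {suc m} c w w≠0 with isZeroVec? (tail w)
  ... | yes tail≈0 = solutions-tail-zero c w w≠0 tail≈0
  ... | no  tail≠0 = trans (solutions-suc c w)
    (trans (Σℕ.sum-cong-≗ (λ i → solutions-nonzero (c ⊕ w fzero ⊛ enum i) (tail w) tail≠0)) (∑-const q (q ^ m)))

  solutions-bound : ∀ {k} c (w : Vector k) → ¬ IsZeroVec (c Vec.∷ w) → q * solutions c w ℕ.≤ q ^ k
  solutions-bound {k} c w c∷w≠0 with isZeroVec? w
  ... | yes w≈0 = subst (ℕ._≤ q ^ k) (sym q*solutions≡0) z≤n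
    where
    c≉0 : ¬ c ≈ 0#
    c≉0 c≈0 = c∷w≠0 λ { fzero → c≈0 ; (fsuc j) → w≈0 j }
    q*solutions≡0 : q * solutions c w ≡ 0
    q*solutions≡0 = begin
      q * solutions c w       ≡⟨ cong (q *_) (solutions-zero c w w≈0) ⟩
      q * (q ^ k * χ₀ c)      ≡⟨ cong (λ e → q * (q ^ k * e)) (χ₀-nonzero c≉0) ⟩
      q * (q ^ k * 0)         ≡⟨ cong (q *_) (ℕP.*-zeroʳ (q ^ k)) ⟩
      q * 0                   ≡⟨ ℕP.*-zeroʳ q ⟩
      0                       ∎
      where open ≡-Reasoning
  solutions-bound {zero}  c w c∷w≠0 | no w≠0 = ⊥-elim (w≠0 (λ ()))
  solutions-bound {suc k} c w c∷w≠0 | no w≠0 = ℕP.≤-reflexive (cong (q *_) (solutions-nonzero c w w≠0))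

  count : ∀ {k} → Vector k → MultisetOfPoints k → ℕ
  count a P = sumOver (λ p → χ₀ (dot a (proj₁ p))) P

  countIn≡count : ∀ {k} (H : HyperplaneRep k) P → countIn H P ≡ count (proj₁ H) P
  countIn≡count H [] = refl
  countIn≡count (a , a≠0) ((v , _) ∷ P) with dot a v ≟F 0#
  ... | yes _ = cong suc (countIn≡count (a , a≠0) P)
  ... | no  _ = countIn≡count (a , a≠0) P

  count-zero : ∀ {k} (a : Vector k) P → IsZeroVec a → count a P ≡ card P
  count-zero a P a≈0 = trans (sumOver-cong (λ p → χ₀-zero (dot-zeroˡ a (proj₁ p) a≈0)) P) (sym (length≡sumOver-1 P))

  excess : ∀ {k} → Vector k → MultisetOfPoints k → ℤ
  excess a P = + count a P ℤ.- + card P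

  -- Unlike IsDivisible, the zero functional is admitted too: it satisfies the condition trivially,
  -- and the pencil argument below then needs no nonzero side conditions.
  Divisible : ∀ {k} → ℕ → MultisetOfPoints k → Set c
  Divisible {k} r P = ∀ (a : Vector k) → + (q ^ r) DS.∣ excess a P

  excess-zero : ∀ {k} (a : Vector k) P → IsZeroVec a → excess a P ≡ + 0
  excess-zero a P a≈0 = trans (cong (λ n → + n ℤ.- + card P) (count-zero a P a≈0)) (ℤP.+-inverseʳ (+ card P))

  excess-zero-divisible : ∀ {k} d (a : Vector k) P → IsZeroVec a → d DS.∣ excess a P
  excess-zero-divisible d a P a≈0 = subst (d DS.∣_) (sym (excess-zero a P a≈0)) (DS.divides (+ 0) refl)

  IsDivisible⇒Divisible : ∀ {k} r (P : MultisetOfPoints k) → IsDivisible r P → Divisible r P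
  IsDivisible⇒Divisible r P P-div a with isZeroVec? a
  ... | yes a≈0 = excess-zero-divisible (+ (q ^ r)) a P a≈0
  ... | no  a≠0 = DS.∣ᵤ⇒∣ (subst (λ n → + (q ^ r) ∣ℤ (+ n ℤ.- + card P)) (countIn≡count (a , a≠0) P) (P-div (a , a≠0)))

  Divisible⇒IsDivisible : ∀ {k} r (P : MultisetOfPoints k) → Divisible r P → IsDivisible r P
  Divisible⇒IsDivisible r P P-div H =
    DS.∣⇒∣ᵤ (subst (λ n → + (q ^ r) DS.∣ (+ n ℤ.- + card P)) (sym (countIn≡count H P)) (P-div (proj₁ H)))

  card-copies : ∀ {k} n (P : MultisetOfPoints k) → card (copies n P) ≡ n * card P
  card-copies n P = begin
    card (copies n P)                   ≡⟨ length≡sumOver-1 (copies n P) ⟩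
    sumOver (λ _ → 1) (copies n P)      ≡⟨ sumOver-copies (λ _ → 1) n P ⟩
    n * sumOver (λ _ → 1) P             ≡⟨ cong (n *_) (length≡sumOver-1 P) ⟨
    n * card P                          ∎
    where open ≡-Reasoning

  excess-++ : ∀ {k} (a : Vector k) P Q → excess a (P ++ Q) ≡ excess a P ℤ.+ excess a Q
  excess-++ a P Q = begin
    + count a (P ++ Q) ℤ.- + card (P ++ Q)
      ≡⟨ cong₂ (λ m n → + m ℤ.- + n) (sumOver-++ _ P Q) (ListP.length-++ P) ⟩
    + (count a P + count a Q) ℤ.- + (card P + card Q)
      ≡⟨ cong₂ ℤ._-_ (ℤP.pos-+ (count a P) _) (ℤP.pos-+ (card P) _) ⟩
    (+ count a P ℤ.+ + count a Q) ℤ.- (+ card P ℤ.+ + card Q)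
      ≡⟨ regroup (+ count a P) (+ count a Q) (+ card P) (+ card Q) ⟩
    excess a P ℤ.+ excess a Q
      ∎
    where
    open ≡-Reasoning
    regroup : ∀ x y u v → (x ℤ.+ y) ℤ.- (u ℤ.+ v) ≡ (x ℤ.- u) ℤ.+ (y ℤ.- v)
    regroup = solve-∀

  excess-copies : ∀ {k} (a : Vector k) n P → excess a (copies n P) ≡ + n ℤ.* excess a P
  excess-copies a n P = begin
    + count a (copies n P) ℤ.- + card (copies n P)
      ≡⟨ cong₂ (λ m n → + m ℤ.- + n) (sumOver-copies _ n P) (card-copies n P) ⟩
    + (n * count a P) ℤ.- + (n * card P)
      ≡⟨ cong₂ ℤ._-_ (ℤP.pos-* n (count a P)) (ℤP.pos-* n (card P)) ⟩
    + n ℤ.* + count a P ℤ.- + n ℤ.* + card P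
      ≡⟨ factor (+ n) _ _ ⟩
    + n ℤ.* excess a P
      ∎
    where
    open ≡-Reasoning
    factor : ∀ x y z → x ℤ.* y ℤ.- x ℤ.* z ≡ x ℤ.* (y ℤ.- z)
    factor = solve-∀

  shift : ∀ {k} → PointRep k → PointRep (suc k)
  shift (v , v≠0) = 0# Vec.∷ v , λ 0∷v≈0 → v≠0 (0∷v≈0 ∘ fsuc)

  count-shift : ∀ {k} (a : Vector (suc k)) P → count a (map shift P) ≡ count (tail a) P
  count-shift a P = trans (sumOver-map _ shift P)
    (sumOver-cong (λ p → χ₀-cong (F.trans (F.+-congʳ (F.zeroʳ (a fzero))) (F.+-identityˡ _))) P)

  excess-shift : ∀ {k} (a : Vector (suc k)) P → excess a (map shift P) ≡ excess (tail a) P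
  excess-shift a P = cong₂ (λ m n → + m ℤ.- + n) (count-shift a P) (ListP.length-map shift P)

  ++-divisible : ∀ {k r} {P Q : MultisetOfPoints k} → Divisible r P → Divisible r Q → Divisible r (P ++ Q)
  ++-divisible {P = P} {Q} P-div Q-div a =
    subst (+ _ DS.∣_) (sym (excess-++ a P Q)) (DS.∣m∣n⇒∣m+n (P-div a) (Q-div a))

  copies-divisible : ∀ {k r} n {P : MultisetOfPoints k} → Divisible r P → Divisible r (copies n P)
  copies-divisible n {P} P-div a =
    subst (+ _ DS.∣_) (sym (excess-copies a n P)) (DS.∣n⇒∣m*n (+ n) (P-div a))

  shift-copies-divisible : ∀ {k r} {P : MultisetOfPoints k} → Divisible r P → Divisible (suc r) (copies q (map shift P))
  shift-copies-divisible {r = r} {P} P-div a =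
    subst₂ DS._∣_ (sym (ℤP.pos-* q (q ^ r))) (sym (trans (excess-copies a q (map shift P)) (cong (+ q ℤ.*_) (excess-shift a P))))
           (DS.*-monoʳ-∣ (+ q) (P-div (tail a)))

  -- Sufficiency: projective spaces

  affinePoint : ∀ {d} → Vector d → PointRep (suc d)
  affinePoint x = 1# Vec.∷ x , λ 1∷x≈0 → F.0≉1 (F.sym (1∷x≈0 fzero))

  -- One spanning vector per point of PG(d - 1, q), normalised to have first nonzero coordinate 1.
  projectiveSpace : ∀ d → MultisetOfPoints d
  projectiveSpace zero    = []
  projectiveSpace (suc d) = map affinePoint (vectors d) ++ map shift (projectiveSpace d)

  card-projectiveSpace : ∀ d → card (projectiveSpace d) ≡ geomFrom q 0 d
  card-projectiveSpace zero    = refl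
  card-projectiveSpace (suc d) = begin
    card (map affinePoint (vectors d) ++ map shift (projectiveSpace d))
      ≡⟨ ListP.length-++ (map affinePoint (vectors d)) ⟩
    length (map affinePoint (vectors d)) + card (map shift (projectiveSpace d))
      ≡⟨ cong₂ _+_ (trans (ListP.length-map affinePoint (vectors d)) (length-vectors d))
                   (trans (ListP.length-map shift (projectiveSpace d)) (card-projectiveSpace d)) ⟩
    q ^ d + geomFrom q 0 d
      ≡⟨ ℕP.+-comm (q ^ d) (geomFrom q 0 d) ⟩
    geomFrom q 0 d + q ^ d
      ≡⟨ Expansion.geomFrom-snoc q 0 d ⟨
    geomFrom q 0 (suc d)
      ∎
    where open ≡-Reasoning

  count-projectiveSpace-suc : ∀ {d} (a : Vector (suc d)) →
    count a (projectiveSpace (suc d)) ≡ solutions (a fzero ⊛ 1#) (tail a) + count (tail a) (projectiveSpace d)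
  count-projectiveSpace-suc {d} a = begin
    count a (map affinePoint (vectors d) ++ map shift (projectiveSpace d))
      ≡⟨ sumOver-++ _ (map affinePoint (vectors d)) _ ⟩
    count a (map affinePoint (vectors d)) + count a (map shift (projectiveSpace d))
      ≡⟨ cong₂ _+_ (sumOver-map _ affinePoint (vectors d)) (count-shift a (projectiveSpace d)) ⟩
    solutions (a fzero ⊛ 1#) (tail a) + count (tail a) (projectiveSpace d)
      ∎
    where open ≡-Reasoning

  count-projectiveSpace : ∀ {d} (a : Vector (suc d)) → ¬ IsZeroVec a →
                               count a (projectiveSpace (suc d)) + q ^ d ≡ geomFrom q 0 (suc d)
  count-projectiveSpace {d} a a≠0 with isZeroVec? (tail a)
  ... | yes tail≈0 = begin
    count a (projectiveSpace (suc d)) + q ^ d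
      ≡⟨ cong (_+ q ^ d) (count-projectiveSpace-suc a) ⟩
    solutions (a fzero ⊛ 1#) (tail a) + count (tail a) (projectiveSpace d) + q ^ d
      ≡⟨ cong (λ s → s + count (tail a) (projectiveSpace d) + q ^ d) no-affine-solutions ⟩
    count (tail a) (projectiveSpace d) + q ^ d
      ≡⟨ cong (_+ q ^ d) (trans (count-zero (tail a) (projectiveSpace d) tail≈0) (card-projectiveSpace d)) ⟩
    geomFrom q 0 d + q ^ d
      ≡⟨ Expansion.geomFrom-snoc q 0 d ⟨
    geomFrom q 0 (suc d)
      ∎
    where
    open ≡-Reasoning
    head≉0 : ¬ a fzero ⊛ 1# ≈ 0#
    head≉0 a₀≈0 = a≠0 λ { fzero → F.trans (F.sym (F.*-identityʳ (a fzero))) a₀≈0 ; (fsuc j) → tail≈0 j }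
    no-affine-solutions : solutions (a fzero ⊛ 1#) (tail a) ≡ 0
    no-affine-solutions = trans (solutions-zero _ (tail a) tail≈0)
                                (trans (cong (q ^ d *_) (χ₀-nonzero head≉0)) (ℕP.*-zeroʳ (q ^ d)))
  count-projectiveSpace {zero}  a a≠0 | no tail≠0 = ⊥-elim (tail≠0 (λ ()))
  count-projectiveSpace {suc d} a a≠0 | no tail≠0 = begin
    count a (projectiveSpace (suc (suc d))) + q ^ suc d
      ≡⟨ cong (_+ q ^ suc d) (count-projectiveSpace-suc a) ⟩
    solutions (a fzero ⊛ 1#) (tail a) + count (tail a) (projectiveSpace (suc d)) + q ^ suc d
      ≡⟨ cong (λ s → s + count (tail a) (projectiveSpace (suc d)) + q ^ suc d) (solutions-nonzero _ (tail a) tail≠0) ⟩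
    q ^ d + count (tail a) (projectiveSpace (suc d)) + q ^ suc d
      ≡⟨ cong (_+ q ^ suc d) (trans (ℕP.+-comm (q ^ d) _) (count-projectiveSpace (tail a) tail≠0)) ⟩
    geomFrom q 0 (suc d) + q ^ suc d
      ≡⟨ Expansion.geomFrom-snoc q 0 (suc d) ⟨
    geomFrom q 0 (suc (suc d))
      ∎
    where open ≡-Reasoning

  projectiveSpace-divisible : ∀ d → Divisible d (projectiveSpace (suc d))
  projectiveSpace-divisible d a with isZeroVec? a
  ... | yes a≈0 = excess-zero-divisible (+ (q ^ d)) a (projectiveSpace (suc d)) a≈0
  ... | no  a≠0 = DS.divides (ℤ.- + 1) (begin
    + m ℤ.- + card (projectiveSpace (suc d))    ≡⟨ cong (λ n → + m ℤ.- + n) (card-projectiveSpace (suc d)) ⟩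
    + m ℤ.- + geomFrom q 0 (suc d)              ≡⟨ cong (λ n → + m ℤ.- + n) (count-projectiveSpace a a≠0) ⟨
    + m ℤ.- + (m + q ^ d)                       ≡⟨ cong (ℤ._-_ (+ m)) (ℤP.pos-+ m (q ^ d)) ⟩
    + m ℤ.- (+ m ℤ.+ + (q ^ d))                 ≡⟨ cancel (+ m) (+ (q ^ d)) ⟩
    ℤ.- + 1 ℤ.* + (q ^ d)                       ∎)
    where
    open ≡-Reasoning
    m = count a (projectiveSpace (suc d))
    cancel : ∀ x y → x ℤ.- (x ℤ.+ y) ≡ ℤ.- + 1 ℤ.* y
    cancel = solve-∀

  open Expansion q using (value; value-zero; value-tail)

  card-copies-projectiveSpace : ∀ r x → + 0 ≤ x → + card (copies ∣ x ∣ (projectiveSpace (suc r))) ≡ x ℤ.* + s q r 0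
  card-copies-projectiveSpace r x 0≤x = begin
    + card (copies ∣ x ∣ (projectiveSpace (suc r)))
      ≡⟨ cong +_ (card-copies ∣ x ∣ (projectiveSpace (suc r))) ⟩
    + (∣ x ∣ * card (projectiveSpace (suc r)))
      ≡⟨ ℤP.pos-* ∣ x ∣ _ ⟩
    + ∣ x ∣ ℤ.* + card (projectiveSpace (suc r))
      ≡⟨ cong₂ ℤ._*_ (ℤP.0≤i⇒+∣i∣≡i 0≤x) (cong +_ (card-projectiveSpace (suc r))) ⟩
    x ℤ.* + s q r 0                                       ∎
    where open ≡-Reasoning

  divisibleMultiset : ∀ r (a : Fin (suc r) → ℤ) → (∀ i → + 0 ≤ a i) →
                      Σ (MultisetOfPoints (suc r)) λ P → Divisible r P × (+ card P ≡ value r a)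
  divisibleMultiset zero a a≥0 = P , (λ b → DS.divides (excess b P) (sym (ℤP.*-identityʳ (excess b P)))) , card≡
    where
    P = copies ∣ a fzero ∣ (projectiveSpace 1)
    card≡ : + card P ≡ value 0 a
    card≡ = trans (card-copies-projectiveSpace 0 (a fzero) (a≥0 fzero)) (sym (ℤP.+-identityʳ _))
  divisibleMultiset (suc r) a a≥0 = PG ++ lifted , ++-divisible {r = suc r} {PG} {lifted} PG-div lifted-div , card≡
    where
    open ≡-Reasoning
    Q = divisibleMultiset r (tail a) (a≥0 ∘ fsuc)
    PG = copies ∣ a fzero ∣ (projectiveSpace (suc (suc r)))
    lifted = copies q (map shift (proj₁ Q))
    PG-div : Divisible (suc r) PG
    PG-div = copies-divisible {r = suc r} ∣ a fzero ∣ {projectiveSpace (suc (suc r))} (projectiveSpace-divisible (suc r))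
    lifted-div : Divisible (suc r) lifted
    lifted-div = shift-copies-divisible {r = r} {proj₁ Q} (proj₁ (proj₂ Q))
    card-lifted : + card lifted ≡ + q ℤ.* value r (tail a)
    card-lifted = begin
      + card lifted                  ≡⟨ cong +_ (trans (card-copies q _) (cong (q *_) (ListP.length-map shift (proj₁ Q)))) ⟩
      + (q * card (proj₁ Q))         ≡⟨ ℤP.pos-* q _ ⟩
      + q ℤ.* + card (proj₁ Q)       ≡⟨ cong (+ q ℤ.*_) (proj₂ (proj₂ Q)) ⟩
      + q ℤ.* value r (tail a)       ∎
    card≡ : + card (PG ++ lifted) ≡ value (suc r) a
    card≡ = begin
      + card (PG ++ lifted)
        ≡⟨ cong +_ (ListP.length-++ PG) ⟩
      + (card PG + card lifted)
        ≡⟨ ℤP.pos-+ (card PG) (card lifted) ⟩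
      + card PG ℤ.+ + card lifted
        ≡⟨ cong₂ ℤ._+_ (card-copies-projectiveSpace (suc r) (a fzero) (a≥0 fzero)) card-lifted ⟩
      a fzero ℤ.* + s q (suc r) 0 ℤ.+ + q ℤ.* value r (tail a)
        ≡⟨ value-tail r a ⟨
      value (suc r) a                                            ∎

  -- Necessity: hyperplane sections

  -- A point lies on at most q^(k-1) of the q^k hyperplanes with normal vector (1, x), so one of them
  -- meets P in at most #P / q points.
  sparseHyperplane : ∀ {k} (P : MultisetOfPoints (suc k)) → ∃ λ x → q * count (1# Vec.∷ x) P ℕ.≤ card P
  sparseHyperplane {k} P = sumOver<⇒∃≤ (λ x → q * count (1# Vec.∷ x) P) (card P) (vectors k) (begin-strict
    sumOver (λ x → q * count (1# Vec.∷ x) P) (vectors k)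
      ≡⟨ sumOver-cong (λ x → sumOver-*ˡ q _ P) (vectors k) ⟨
    sumOver (λ x → sumOver (λ p → q * χ₀ (dot (1# Vec.∷ x) (proj₁ p))) P) (vectors k)
      ≡⟨ sumOver-comm (λ x p → q * χ₀ (dot (1# Vec.∷ x) (proj₁ p))) (vectors k) P ⟩
    sumOver (λ p → sumOver (λ x → q * χ₀ (dot (1# Vec.∷ x) (proj₁ p))) (vectors k)) P
      ≡⟨ sumOver-cong (λ p → trans (sumOver-*ˡ q _ (vectors k)) (cong (q *_) (incidences p))) P ⟩
    sumOver (λ p → q * solutions (1# ⊛ proj₁ p fzero) (tail (proj₁ p))) P
      ≤⟨ sumOver-mono (λ p → solutions-bound _ (tail (proj₁ p)) (nonzero p)) P ⟩
    sumOver (λ _ → q ^ k) P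
      ≡⟨ sumOver-const (q ^ k) P ⟩
    card P * q ^ k
      ≡⟨ ℕP.*-comm (card P) (q ^ k) ⟩
    q ^ k * card P
      <⟨ ℕP.m<n+m (q ^ k * card P) (ℕP.m^n>0 q k) ⟩
    q ^ k + q ^ k * card P
      ≡⟨ ℕP.*-suc (q ^ k) (card P) ⟨
    q ^ k * suc (card P)
      ≡⟨ cong (_* suc (card P)) (length-vectors k) ⟨
    length (vectors k) * suc (card P)
      ∎)
    where
    open ℕP.≤-Reasoning
    incidences : ∀ (p : PointRep (suc k)) →
                 sumOver (λ x → χ₀ (dot (1# Vec.∷ x) (proj₁ p))) (vectors k) ≡ solutions (1# ⊛ proj₁ p fzero) (tail (proj₁ p))
    incidences (v , _) = sumOver-cong (λ x → χ₀-cong (F.+-congˡ (dot-comm x (tail v)))) (vectors k)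
    nonzero : ∀ (p : PointRep (suc k)) → ¬ IsZeroVec ((1# ⊛ proj₁ p fzero) Vec.∷ tail (proj₁ p))
    nonzero (v , v≠0) 1v₀∷v≈0 = v≠0 λ
      { fzero    → F.trans (F.sym (F.*-identityˡ (v fzero))) (1v₀∷v≈0 fzero)
      ; (fsuc j) → 1v₀∷v≈0 (fsuc j) }

  restrict : ∀ {k} → Vector k → MultisetOfPoints k → MultisetOfPoints k
  restrict a = filter (λ p → dot a (proj₁ p) ≟F 0#)

  card-restrict : ∀ {k} (a : Vector k) P → card (restrict a P) ≡ count a P
  card-restrict a []            = refl
  card-restrict a ((v , _) ∷ P) with dot a v ≟F 0#
  ... | yes _ = cong suc (card-restrict a P)
  ... | no  _ = card-restrict a P

  count-restrict : ∀ {k} (a c : Vector k) P →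
                   count c (restrict a P) ≡ sumOver (λ p → χ₀ (dot a (proj₁ p)) * χ₀ (dot c (proj₁ p))) P
  count-restrict a c []            = refl
  count-restrict a c ((v , _) ∷ P) with dot a v ≟F 0#
  ... | yes _ = cong₂ _+_ (sym (ℕP.+-identityʳ _)) (count-restrict a c P)
  ... | no  _ = count-restrict a c P

  ∑-χ₀-pencil : ∀ x y → Σℕ.sum (λ l → χ₀ (x ⊕ enum l ⊛ y)) + χ₀ y ≡ 1 + q * (χ₀ y * χ₀ x)
  ∑-χ₀-pencil x y with y ≟F 0#
  ... | yes y≈0 = begin
    Σℕ.sum (λ l → χ₀ (x ⊕ enum l ⊛ y)) + 1   ≡⟨ cong (_+ 1) (Σℕ.sum-cong-≗ {q} (λ l → χ₀-cong (x⊕ly≈x l))) ⟩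
    Σℕ.sum (λ (_ : Fin q) → χ₀ x) + 1                  ≡⟨ cong (_+ 1) (∑-const q (χ₀ x)) ⟩
    q * χ₀ x + 1                             ≡⟨ ℕP.+-comm (q * χ₀ x) 1 ⟩
    1 + q * χ₀ x                             ≡⟨ cong (λ n → 1 + q * n) (ℕP.+-identityʳ (χ₀ x)) ⟨
    1 + q * (1 * χ₀ x)                       ∎
    where
    open ≡-Reasoning
    x⊕ly≈x : ∀ l → x ⊕ enum l ⊛ y ≈ x
    x⊕ly≈x l = F.trans (F.+-congˡ (F.trans (F.*-congˡ y≈0) (F.zeroʳ (enum l)))) (F.+-identityʳ x)
  ... | no y≉0 = begin
    Σℕ.sum (λ l → χ₀ (x ⊕ enum l ⊛ y)) + 0   ≡⟨ ℕP.+-identityʳ _ ⟩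
    Σℕ.sum (λ l → χ₀ (x ⊕ enum l ⊛ y))       ≡⟨ Σℕ.sum-cong-≗ (λ l → χ₀-cong (F.+-congˡ (F.*-comm (enum l) y))) ⟩
    Σℕ.sum (λ l → χ₀ (x ⊕ y ⊛ enum l))       ≡⟨ ∑-χ₀-linear x y≉0 ⟩
    1                                        ≡⟨ cong suc (ℕP.*-zeroʳ q) ⟨
    1 + q * 0                                ∎
    where open ≡-Reasoning

  -- The hyperplanes c + λ a (λ ∈ F) and a form the pencil through a ∩ c: a point outside a lies on
  -- exactly one of the c + λ a, a point on a lies on all of them or on none.
  count-pencil : ∀ {k} (a c : Vector k) P →
                 Σℕ.sum (λ l → count (λ j → c j ⊕ enum l ⊛ a j) P) + count a P ≡ card P + q * count c (restrict a P)
  count-pencil a c P = begin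
    Σℕ.sum (λ l → count (λ j → c j ⊕ enum l ⊛ a j) P) + count a P
      ≡⟨ cong (_+ count a P) (∑-sumOver-comm (λ l p → χ₀ (dot (λ j → c j ⊕ enum l ⊛ a j) (proj₁ p))) P) ⟩
    sumOver (λ p → Σℕ.sum (λ l → χ₀ (dot (λ j → c j ⊕ enum l ⊛ a j) (proj₁ p)))) P + count a P
      ≡⟨ sumOver-+ _ _ P ⟨
    sumOver (λ p → Σℕ.sum (λ l → χ₀ (dot (λ j → c j ⊕ enum l ⊛ a j) (proj₁ p))) + χ₀ (dot a (proj₁ p))) P
      ≡⟨ sumOver-cong per-point P ⟩
    sumOver (λ p → 1 + q * (χ₀ (dot a (proj₁ p)) * χ₀ (dot c (proj₁ p)))) P
      ≡⟨ sumOver-+ (λ _ → 1) _ P ⟩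
    sumOver (λ _ → 1) P + sumOver (λ p → q * (χ₀ (dot a (proj₁ p)) * χ₀ (dot c (proj₁ p)))) P
      ≡⟨ cong₂ _+_ (sym (length≡sumOver-1 P)) (trans (sumOver-*ˡ q _ P) (cong (q *_) (sym (count-restrict a c P)))) ⟩
    card P + q * count c (restrict a P)
      ∎
    where
    open ≡-Reasoning
    per-point : ∀ (p : PointRep _) → Σℕ.sum (λ l → χ₀ (dot (λ j → c j ⊕ enum l ⊛ a j) (proj₁ p))) + χ₀ (dot a (proj₁ p))
                                      ≡ 1 + q * (χ₀ (dot a (proj₁ p)) * χ₀ (dot c (proj₁ p)))
    per-point (v , _) = trans (cong (_+ χ₀ (dot a v)) (Σℕ.sum-cong-≗ (λ l → χ₀-cong (dot-linearˡ c a v (enum l)))))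
                              (∑-χ₀-pencil (dot c v) (dot a v))

  restrict-divisible : ∀ {k} r (P : MultisetOfPoints k) → Divisible (suc r) P → ∀ a → Divisible r (restrict a P)
  restrict-divisible r P P-div a c =
    subst (+ (q ^ r) DS.∣_) (sym excess≡) (DS.∣m∣n⇒∣m-n (cancel q[L-n]-div) (weaken (P-div a)))
    where
    open ≡-Reasoning
    n = card P
    m = count a P
    L = count c (restrict a P)
    S = Σℕ.sum (λ l → count (λ j → c j ⊕ enum l ⊛ a j) P)
    cancel : ∀ {x} → + (q ^ suc r) DS.∣ (+ q ℤ.* x) → + (q ^ r) DS.∣ x
    cancel q^[r+1]∣qx = DS.*-cancelˡ-∣ (+ q) (subst (DS._∣ _) (ℤP.pos-* q (q ^ r)) q^[r+1]∣qx)
    weaken : ∀ {x} → + (q ^ suc r) DS.∣ x → + (q ^ r) DS.∣ x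
    weaken = DS.∣-trans (DS.divides (+ q) (ℤP.pos-* q (q ^ r)))
    rearrange : ∀ s m n l q → q ℤ.* (l ℤ.- n) ≡ (s ℤ.- q ℤ.* n) ℤ.+ (m ℤ.- n) ℤ.+ ((n ℤ.+ q ℤ.* l) ℤ.- (s ℤ.+ m))
    rearrange = solve-∀
    count-pencil-ℤ : + S ℤ.+ + m ≡ + n ℤ.+ + q ℤ.* + L
    count-pencil-ℤ = begin
      + S ℤ.+ + m            ≡⟨ ℤP.pos-+ S m ⟨
      + (S + m)              ≡⟨ cong +_ (count-pencil a c P) ⟩
      + (n + q * L)          ≡⟨ ℤP.pos-+ n (q * L) ⟩
      + n ℤ.+ + (q * L)      ≡⟨ cong (ℤ._+_ (+ n)) (ℤP.pos-* q L) ⟩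
      + n ℤ.+ + q ℤ.* + L    ∎
    q[L-n]-div : + (q ^ suc r) DS.∣ (+ q ℤ.* (+ L ℤ.- + n))
    q[L-n]-div = subst (+ (q ^ suc r) DS.∣_) (sym (begin
      + q ℤ.* (+ L ℤ.- + n)
        ≡⟨ rearrange (+ S) (+ m) (+ n) (+ L) (+ q) ⟩
      (+ S ℤ.- + q ℤ.* + n) ℤ.+ (+ m ℤ.- + n) ℤ.+ ((+ n ℤ.+ + q ℤ.* + L) ℤ.- (+ S ℤ.+ + m))
        ≡⟨ cong₂ (λ x y → (+ S ℤ.- x) ℤ.+ (+ m ℤ.- + n) ℤ.+ y) (ℤP.pos-* q n)
                 (sym (trans (cong (ℤ._- (+ S ℤ.+ + m)) (sym count-pencil-ℤ)) (ℤP.+-inverseʳ (+ S ℤ.+ + m)))) ⟨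
      (+ S ℤ.- + (q * n)) ℤ.+ (+ m ℤ.- + n) ℤ.+ + 0
        ≡⟨ ℤP.+-identityʳ _ ⟩
      (+ S ℤ.- + (q * n)) ℤ.+ (+ m ℤ.- + n)
        ∎))
      (DS.∣m∣n⇒∣m+n (∑-divisible _ _ n (λ l → P-div (λ j → c j ⊕ enum l ⊛ a j))) (P-div a))
    excess≡ : excess c (restrict a P) ≡ (+ L ℤ.- + n) ℤ.- (+ m ℤ.- + n)
    excess≡ = trans (cong (λ k → + L ℤ.- + k) (card-restrict a P)) (telescope (+ L) (+ n) (+ m))
      where
      telescope : ∀ x y z → x ℤ.- z ≡ (x ℤ.- y) ℤ.- (z ℤ.- y)
      telescope = solve-∀

  open Expansion q using (value-carry; last-nonneg; quotient-nonneg)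

  divisible⇒leading-nonneg : ∀ r {k} (P : MultisetOfPoints (suc k)) → Divisible r P → (a : Fin (suc r) → ℤ) →
              (∀ i → toℕ i ℕ.< r → a i ℤ.< + q) → + card P ≡ value r a → + 0 ≤ a (fromℕ r)
  divisible⇒leading-nonneg zero    P P-div a digits card≡ = subst (+ 0 ≤_) (trans card≡ (value-zero a)) (ℤ.+≤+ z≤n)
  divisible⇒leading-nonneg (suc r) P P-div a digits card≡ = last-nonneg r a u init-digits q[n+uQ]≤n 0≤S+u
    where
    open ≡-Reasoning
    H = 1# Vec.∷ proj₁ (sparseHyperplane P)
    n = value (suc r) a
    S = Σℤ.sum a
    Q = + (q ^ suc r)
    u = DS._∣_.quotient (P-div H)
    m≡n+uQ : + count H P ≡ n ℤ.+ u ℤ.* Q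
    m≡n+uQ = begin
      + count H P                                 ≡⟨ split (+ count H P) (+ card P) ⟩
      + card P ℤ.+ (+ count H P ℤ.- + card P)     ≡⟨ cong₂ ℤ._+_ card≡ (DS._∣_.equality (P-div H)) ⟩
      n ℤ.+ u ℤ.* Q                               ∎
      where
      split : ∀ x y → x ≡ y ℤ.+ (x ℤ.- y)
      split = solve-∀
    q[n+uQ]≤n : + q ℤ.* (n ℤ.+ u ℤ.* Q) ≤ n
    q[n+uQ]≤n = subst₂ _≤_ (trans (ℤP.pos-* q (count H P)) (cong (+ q ℤ.*_) m≡n+uQ)) card≡ (ℤ.+≤+ (proj₂ (sparseHyperplane P)))
    init-digits : ∀ i → init a i ℤ.< + q
    init-digits i = digits (inject₁ i) (FinP.inject₁ℕ< i)
    b : Fin (suc r) → ℤ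
    b = updateAt (init a) (fromℕ r) (ℤ._+ + q ℤ.* (S ℤ.+ u))
    b-digits : ∀ i → toℕ i ℕ.< r → b i ℤ.< + q
    b-digits i i<r = subst (ℤ._< + q) (sym (updateAt-minimal i (fromℕ r) (init a) i≢r)) (init-digits i)
      where
      i≢r : i ≢ fromℕ r
      i≢r i≡r = ℕP.<-irrefl (trans (cong toℕ i≡r) (FinP.toℕ-fromℕ r)) i<r
    card-b : + card (restrict H P) ≡ value r b
    card-b = trans (cong +_ (card-restrict H P)) (trans m≡n+uQ (value-carry r a u))
    0≤S+u : + 0 ≤ S ℤ.+ u
    0≤S+u = quotient-nonneg
      (subst (+ 0 ≤_) (updateAt-updates (fromℕ r) (init a))
             (divisible⇒leading-nonneg r (restrict H P) (restrict-divisible r P P-div H) b b-digits card-b))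
      (init-digits (fromℕ r))

digits-nonneg : ∀ {q r} (a : Fin (suc r) → ℤ) →
                (∀ i → toℕ i ℕ.< r → (+ 0 ≤ a i) × (a i ℤ.< + q)) → + 0 ≤ leading a → ∀ i → + 0 ≤ a i
digits-nonneg {r = r} a digits 0≤aᵣ i with toℕ i ℕ.<? r
... | yes i<r = proj₁ (digits i i<r)
... | no  i≮r = subst (λ j → + 0 ≤ a j) (sym i≡r) 0≤aᵣ
  where
  i≡r : i ≡ fromℕ r
  i≡r = FinP.toℕ-injective (trans (ℕP.≤∧≮⇒≡ (FinP.toℕ≤pred[n] i) i≮r) (sym (FinP.toℕ-fromℕ r)))

-- q is a prime power because F exists.
mainTheorem2 : ∀ {c ℓ : Level} (q : ℕ) → IsPrimePower q → (F : FiniteField c ℓ q)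
    → (n : ℤ) (r : ℕ) (a : Fin (suc r) → ℤ) → IsSAdicExpansion q r n a
    → (ExistsDivisibleMultiset F r n ⇔ (+ 0 ≤ leading a))
mainTheorem2 q _ F n r a (digits , n≡) = mk⇔ necessary sufficient
  where
  open PointCounting F
  n≡value : n ≡ Expansion.value q r a
  n≡value = trans n≡ (sumℤ≡sum (λ i → a i ℤ.* + s q r (toℕ i)))
  necessary : ExistsDivisibleMultiset F r n → + 0 ≤ leading a
  necessary (suc k , _ , P , P-div , card≡n) =
    divisible⇒leading-nonneg r P (IsDivisible⇒Divisible r P P-div) a (λ i i<r → proj₂ (digits i i<r)) (trans card≡n n≡value)
  sufficient : + 0 ≤ leading a → ExistsDivisibleMultiset F r n
  sufficient 0≤aᵣ with divisibleMultiset r a (digits-nonneg a digits 0≤aᵣ)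
  ... | P , P-div , card≡value = suc r , ℕP.n<1+n r , P , Divisible⇒IsDivisible r P P-div , trans card≡value (sym n≡value)
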